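{- Let $n\ge 2$ and let $V_n$ be the set of triples $(u,v,w)\in S_n^3$ with $l(u)+l(v)+l(w)=\binom n2$. Let $f:V_n\to\mathbb Z$ satisfy: (1) whenever $(u,v,w)\in S_n^3$ with $l(u)+l(v)+l(w)=\binom n2-1$ and $1\le i\le n-1$ are such that $u(i)<u(i+1)$, $v(i)<v(i+1)$, $w(i)<w(i+1)$, one has $f(us_i,v,w)=f(u,vs_i,w)=f(u,v,ws_i)$; (2) $f(u,v,w)=0$ whenever there is some $i$ with $u(i)<u(i+1)$, $v(i)<v(i+1)$ and $w(i)<w(i+1)$; (3) $f(\mathrm{id},\mathrm{id},w_0)=1$. Let $\pi,\sigma\in S_n$ with $l(\pi)+l(\sigma)=\binom n2$. Then $f(\pi,\mathrm{id},\sigma)=1$ if $\pi(m)=n+1-\sigma(m)$ for all $m$, and $f(\pi,\mathrm{id},\sigma)=0$ otherwise.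
   Context: $l(w)$ is the number of inversions of $w\in S_n$, $w_0$ is the permutation $w_0(m)=n+1-m$, $\mathrm{id}$ is the identity, $s_i$ is the transposition $i\leftrightarrow i+1$, and $us_i$ denotes $u$ with its entries in positions $i$ and $i+1$ exchanged. -}

module Defs where

open import Data.Nat using (ℕ; suc; _+_; _<ᵇ_)
open import Data.Bool using (Bool; if_then_else_; _∧_)
open import Data.Fin using (Fin; toℕ; opposite)
open import Data.Vec using (Vec; lookup; tabulate; sum; _[_]≔_; allFin)
open import Relation.Binary.PropositionalEquality using (_≡_)

-- A permutation w ∈ S_n is represented by its one-line notation:
-- the vector (w(1), …, w(n)), with positions and values in Fin n
-- (0-indexed: value k ∈ Fin n stands for k+1).
Word : ℕ → Set
Word n = Vec (Fin n) n

IsPerm : ∀ {n} → Word n → Set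
IsPerm {n} w = ∀ (a b : Fin n) → lookup w a ≡ lookup w b → a ≡ b

len : ∀ {n} → Word n → ℕ
len w = sum (tabulate λ a → sum (tabulate λ b →
          if (toℕ a <ᵇ toℕ b) ∧ (toℕ (lookup w b) <ᵇ toℕ (lookup w a)) then 1 else 0))

-- w s_i : exchange the entries in positions i and j (used with j = i+1).
swapAt : ∀ {n} → Word n → Fin n → Fin n → Word n
swapAt w i j = (w [ i ]≔ lookup w j) [ j ]≔ lookup w i

idW : ∀ n → Word n
idW n = allFin n

w0 : ∀ n → Word n
w0 n = tabulate opposite

-- Induction on l(π).  If σ has an ascent i at which π descends, condition (1) applied to
-- (π s_i, id, σ) moves s_i from π to σ without changing f, and lowers l(π) by one while
-- keeping l(π) + l(σ) = C(n,2); simultaneous right multiplication by s_i also preserves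
-- π = w0 σ.  If σ and π share an ascent, f vanishes by (2) and π = w0 σ fails.  If σ has
-- no ascent then σ = w0, hence l(π) = 0 and π = id, and (3) gives the value.
module Submission where

open import Defs
open import Data.Nat as ℕ using (ℕ; zero; suc; _+_; _≤_; _<ᵇ_; s≤s)
open import Data.Nat.Properties as ℕ using (+-0-commutativeMonoid)
open import Data.Nat.Combinatorics using (_C_; nC1≡n; nCk+nC[k+1]≡[n+1]C[k+1])
open import Data.Nat.Induction using (<-rec)
open import Data.Integer using (ℤ; +_)
open import Data.Fin as Fin using (Fin; zero; suc; toℕ; _<_; opposite; inject₁; punchIn)
open import Data.Fin.Properties as Fin using (opposite-involutive; toℕ-inject₁; punchInᵢ≢i)
open import Data.Fin.Permutation using (permutation)
open import Data.Vec as Vec using (Vec; _∷_; lookup; tabulate; _[_]≔_)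
open import Data.Vec.Properties using (lookup∘tabulate; tabulate∘lookup; tabulate-cong; lookup-allFin)
open import Data.Bool using (Bool; true; false; if_then_else_; _∧_)
open import Data.Bool.Properties using (∧-zeroʳ; ∧-idem)
open import Data.Empty using (⊥-elim)
open import Data.Product using (_×_; _,_; proj₁; proj₂)
open import Data.Sum using (_⊎_; inj₁; inj₂)
open import Function using (_∘_)
open import Relation.Binary.Definitions using (tri<; tri≈; tri>)
open import Relation.Binary.PropositionalEquality
open import Relation.Nullary using (¬_; yes; no)
open import Relation.Nullary.Reflects using (det; fromEquivalence)
open import Algebra.Properties.CommutativeMonoid.Sum +-0-commutativeMonoid
  using (sum; sum-syntax; sum-remove; sum-permute; sum-cong-≗; sum-replicate-zero)

open ≡-Reasoning

sum-tabulate : ∀ {n} (g : Fin n → ℕ) → Vec.sum (tabulate g) ≡ sum g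
sum-tabulate {zero}  g = refl
sum-tabulate {suc n} g = cong (λ s → g zero + s) (sum-tabulate (g ∘ suc))

sum-suc-at : ∀ {n} {g h : Fin n → ℕ} (k : Fin n) →
  (∀ x → x ≢ k → g x ≡ h x) → g k ≡ suc (h k) → sum g ≡ suc (sum h)
sum-suc-at {suc n} {g} {h} k same bump = begin
  sum g                                ≡⟨ sum-remove {i = k} g ⟩
  g k + sum (g ∘ punchIn k)            ≡⟨ cong₂ _+_ bump (sum-cong-≗ (λ x → same _ (punchInᵢ≢i k x))) ⟩
  suc (h k + sum (h ∘ punchIn k))      ≡⟨ cong suc (sum-remove {i = k} h) ⟨
  suc (sum h)                          ∎

sum-zeros : ∀ n → ∑[ _ < n ] 0 ≡ 0
sum-zeros = sum-replicate-zero

sum-ones : ∀ n → ∑[ _ < n ] 1 ≡ n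
sum-ones zero    = refl
sum-ones (suc n) = cong suc (sum-ones n)

𝟙 : Bool → ℕ
𝟙 b = if b then 1 else 0

ordered-pairs-count : ∀ n → ∑[ a < n ] ∑[ b < n ] 𝟙 (toℕ a <ᵇ toℕ b) ≡ n C 2
ordered-pairs-count zero    = refl
ordered-pairs-count (suc n) = begin
  ∑[ a < suc n ] ∑[ b < suc n ] 𝟙 (toℕ a <ᵇ toℕ b)
    ≡⟨⟩
  ∑[ _ < n ] 1 + ∑[ a < n ] ∑[ b < n ] 𝟙 (toℕ a <ᵇ toℕ b)
    ≡⟨ cong₂ _+_ (trans (sum-ones n) (sym (nC1≡n n))) (ordered-pairs-count n) ⟩
  n C 1 + n C 2
    ≡⟨ nCk+nC[k+1]≡[n+1]C[k+1] n 1 ⟩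
  suc n C 2
    ∎

<ᵇ-asym : ∀ m n → ((m <ᵇ n) ∧ (n <ᵇ m)) ≡ false
<ᵇ-asym zero    zero    = refl
<ᵇ-asym zero    (suc n) = refl
<ᵇ-asym (suc m) zero    = refl
<ᵇ-asym (suc m) (suc n) = <ᵇ-asym m n

<⇒<ᵇ≡true : ∀ {m n} → m ℕ.< n → (m <ᵇ n) ≡ true
<⇒<ᵇ≡true {m} {n} m<n = det (ℕ.<ᵇ-reflects-< m n) (fromEquivalence (λ _ → m<n) (λ _ → _))

≤⇒>ᵇ≡false : ∀ {m n} → m ℕ.≤ n → (n <ᵇ m) ≡ false
≤⇒>ᵇ≡false {m} {n} m≤n = det (ℕ.<ᵇ-reflects-< n m) (fromEquivalence (λ ()) (ℕ.≤⇒≯ m≤n))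

opposite-reverses-< : ∀ {n} {x y : Fin n} → x < y → opposite y < opposite x
opposite-reverses-< {suc n} {x} {y} x<y
  rewrite Fin.opposite-prop x | Fin.opposite-prop y = ℕ.∸-monoʳ-< (s≤s x<y) (Fin.toℕ<n y)

opposite-reverses-≤ : ∀ {n} {x y : Fin n} → x Fin.≤ y → opposite y Fin.≤ opposite x
opposite-reverses-≤ {suc n} {x} {y} x≤y
  rewrite Fin.opposite-prop x | Fin.opposite-prop y = ℕ.∸-monoʳ-≤ n x≤y

opposite-reflects-< : ∀ {n} {x y : Fin n} → opposite y < opposite x → x < y
opposite-reflects-< {x = x} {y} o<o =
  subst₂ _<_ (opposite-involutive x) (opposite-involutive y) (opposite-reverses-< o<o)

opposite-<ᵇ : ∀ {n} (a b : Fin n) → (toℕ (opposite b) <ᵇ toℕ (opposite a)) ≡ (toℕ a <ᵇ toℕ b)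
opposite-<ᵇ a b = det
  (fromEquivalence (opposite-reflects-< ∘ ℕ.<ᵇ⇒< _ _) (ℕ.<⇒<ᵇ ∘ opposite-reverses-<))
  (ℕ.<ᵇ-reflects-< (toℕ a) (toℕ b))

opposite-inject₁ : ∀ {n} (k : Fin n) → opposite (inject₁ k) ≡ suc (opposite k)
opposite-inject₁ zero    = refl
opposite-inject₁ (suc k) = cong inject₁ (opposite-inject₁ k)

Ascent Descent : ∀ {n c} → (Fin (suc n) → Fin c) → Fin n → Set
Ascent  g k = g (inject₁ k) < g (suc k)
Descent g k = g (suc k) < g (inject₁ k)

ascending-≥-index : ∀ {n c} (g : Fin (suc n) → Fin c) → (∀ k → Ascent g k) →
  ∀ m → toℕ m + toℕ (g zero) ≤ toℕ (g m)
ascending-≥-index g asc zero = ℕ.≤-refl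
ascending-≥-index {suc n} g asc (suc m) =
  ℕ.≤-trans (ℕ.≤-reflexive (sym (ℕ.+-suc (toℕ m) _)))
    (ℕ.≤-trans (ℕ.+-monoʳ-≤ (toℕ m) (asc zero)) (ascending-≥-index (g ∘ suc) (asc ∘ suc) m))

ascending⇒≥ : ∀ {n c} (g : Fin (suc n) → Fin c) → (∀ k → Ascent g k) → ∀ m → toℕ m ≤ toℕ (g m)
ascending⇒≥ g asc m = ℕ.≤-trans (ℕ.m≤m+n (toℕ m) _) (ascending-≥-index g asc m)

descending⇒≡opposite : ∀ {n} (g : Fin (suc n) → Fin (suc n)) → (∀ k → Descent g k) →
  ∀ m → g m ≡ opposite m
descending⇒≡opposite g desc m = Fin.≤-antisym upper lower
  where
  upper : g m Fin.≤ opposite m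
  upper = subst (Fin._≤ opposite m) (opposite-involutive (g m))
    (opposite-reverses-≤ (ascending⇒≥ (opposite ∘ g) (opposite-reverses-< ∘ desc) m))

  -- opposite maps the adjacent pair (k, k+1) to (opposite k + 1, opposite k)
  g∘opposite-ascending : ∀ k → Ascent (g ∘ opposite) k
  g∘opposite-ascending k =
    subst (λ x → g x < g (inject₁ (opposite k))) (sym (opposite-inject₁ k)) (desc (opposite k))

  lower : opposite m Fin.≤ g m
  lower = subst (λ x → opposite m Fin.≤ g x) (opposite-involutive m)
    (ascending⇒≥ (g ∘ opposite) g∘opposite-ascending (opposite m))

ascending⇒≡id : ∀ {n} (g : Fin (suc n) → Fin (suc n)) → (∀ k → Ascent g k) → ∀ m → g m ≡ m
ascending⇒≡id g asc m = begin
  g m                        ≡⟨ opposite-involutive (g m) ⟨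
  opposite (opposite (g m))  ≡⟨ cong opposite (descending⇒≡opposite (opposite ∘ g) (opposite-reverses-< ∘ asc) m) ⟩
  opposite (opposite m)      ≡⟨ opposite-involutive m ⟩
  m                          ∎

-- The transposition s_k, by recursion on k (rather than as transpose (inject₁ k) (suc k))
-- so that the lemmas below hold by computation.
swapAdjacent : ∀ {n} → Fin n → Fin (suc n) → Fin (suc n)
swapAdjacent zero    zero          = suc zero
swapAdjacent zero    (suc zero)    = zero
swapAdjacent zero    (suc (suc x)) = suc (suc x)
swapAdjacent (suc k) zero          = zero
swapAdjacent (suc k) (suc x)       = suc (swapAdjacent k x)

swapAdjacent-involutive : ∀ {n} (k : Fin n) x → swapAdjacent k (swapAdjacent k x) ≡ x
swapAdjacent-involutive zero    zero          = refl
swapAdjacent-involutive zero    (suc zero)    = refl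
swapAdjacent-involutive zero    (suc (suc x)) = refl
swapAdjacent-involutive (suc k) zero          = refl
swapAdjacent-involutive (suc k) (suc x)       = cong suc (swapAdjacent-involutive k x)

swapAdjacent-inject₁ : ∀ {n} (k : Fin n) → swapAdjacent k (inject₁ k) ≡ suc k
swapAdjacent-inject₁ zero    = refl
swapAdjacent-inject₁ (suc k) = cong suc (swapAdjacent-inject₁ k)

swapAdjacent-suc : ∀ {n} (k : Fin n) → swapAdjacent k (suc k) ≡ inject₁ k
swapAdjacent-suc zero    = refl
swapAdjacent-suc (suc k) = cong suc (swapAdjacent-suc k)

swapAdjacent-<ᵇ : ∀ {n} (k : Fin n) a b → (a ≡ inject₁ k → b ≢ suc k) → (a ≡ suc k → b ≢ inject₁ k) →
  (toℕ (swapAdjacent k a) <ᵇ toℕ (swapAdjacent k b)) ≡ (toℕ a <ᵇ toℕ b)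
swapAdjacent-<ᵇ zero    zero          zero          _  _  = refl
swapAdjacent-<ᵇ zero    zero          (suc zero)    k₁ _  = ⊥-elim (k₁ refl refl)
swapAdjacent-<ᵇ zero    zero          (suc (suc b)) _  _  = refl
swapAdjacent-<ᵇ zero    (suc zero)    zero          _  k₂ = ⊥-elim (k₂ refl refl)
swapAdjacent-<ᵇ zero    (suc zero)    (suc zero)    _  _  = refl
swapAdjacent-<ᵇ zero    (suc zero)    (suc (suc b)) _  _  = refl
swapAdjacent-<ᵇ zero    (suc (suc a)) zero          _  _  = refl
swapAdjacent-<ᵇ zero    (suc (suc a)) (suc zero)    _  _  = refl
swapAdjacent-<ᵇ zero    (suc (suc a)) (suc (suc b)) _  _  = refl
swapAdjacent-<ᵇ (suc k) zero          zero          _  _  = refl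
swapAdjacent-<ᵇ (suc k) zero          (suc b)       _  _  = refl
swapAdjacent-<ᵇ (suc k) (suc a)       zero          _  _  = refl
swapAdjacent-<ᵇ (suc k) (suc a)       (suc b)       k₁ k₂ =
  swapAdjacent-<ᵇ k a b (λ a≡ b≡ → k₁ (cong suc a≡) (cong suc b≡)) (λ a≡ b≡ → k₂ (cong suc a≡) (cong suc b≡))

inject₁<ᵇsuc : ∀ {n} (k : Fin n) → (toℕ (inject₁ k) <ᵇ toℕ (suc k)) ≡ true
inject₁<ᵇsuc zero    = refl
inject₁<ᵇsuc (suc k) = inject₁<ᵇsuc k

suc<ᵇinject₁ : ∀ {n} (k : Fin n) → (toℕ (suc k) <ᵇ toℕ (inject₁ k)) ≡ false
suc<ᵇinject₁ zero    = refl
suc<ᵇinject₁ (suc k) = suc<ᵇinject₁ k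

sum-swapAdjacent : ∀ {n} (k : Fin n) (g : Fin (suc n) → ℕ) → sum g ≡ sum (g ∘ swapAdjacent k)
sum-swapAdjacent k g =
  sum-permute g (permutation (swapAdjacent k) (swapAdjacent k) (swapAdjacent-involutive k) (swapAdjacent-involutive k))

-- w s_k, i.e. swapAt w (inject₁ k) (suc k), for vectors over any type: the proofs below
-- recurse on the tail, which is not a Word.
infixl 7 _·s_

_·s_ : ∀ {a} {A : Set a} {n} → Vec A (suc n) → Fin n → Vec A (suc n)
w ·s k = (w [ inject₁ k ]≔ lookup w (suc k)) [ suc k ]≔ lookup w (inject₁ k)

lookup-·s : ∀ {a} {A : Set a} {n} (w : Vec A (suc n)) (k : Fin n) x →
  lookup (w ·s k) x ≡ lookup w (swapAdjacent k x)
lookup-·s (_ ∷ _ ∷ _) zero    zero          = refl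
lookup-·s (_ ∷ _ ∷ _) zero    (suc zero)    = refl
lookup-·s (_ ∷ _ ∷ _) zero    (suc (suc x)) = refl
lookup-·s (_ ∷ _)     (suc k) zero          = refl
lookup-·s (_ ∷ w)     (suc k) (suc x)       = lookup-·s w k x

lookup-·s-swapAdjacent : ∀ {a} {A : Set a} {n} (w : Vec A (suc n)) (k : Fin n) x →
  lookup (w ·s k) (swapAdjacent k x) ≡ lookup w x
lookup-·s-swapAdjacent w k x = trans (lookup-·s w k _) (cong (lookup w) (swapAdjacent-involutive k x))

·s-involutive : ∀ {a} {A : Set a} {n} (w : Vec A (suc n)) (k : Fin n) → w ·s k ·s k ≡ w
·s-involutive (_ ∷ _ ∷ _) zero    = refl
·s-involutive (x ∷ w)     (suc k) = cong (x ∷_) (·s-involutive w k)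

·s-preserves-IsPerm : ∀ {n} (w : Word (suc n)) (k : Fin n) → IsPerm w → IsPerm (w ·s k)
·s-preserves-IsPerm w k perm a b wa≡wb = begin
  a                                    ≡⟨ swapAdjacent-involutive k a ⟨
  swapAdjacent k (swapAdjacent k a)    ≡⟨ cong (swapAdjacent k) (perm _ _ (begin
    lookup w (swapAdjacent k a)          ≡⟨ lookup-·s w k a ⟨
    lookup (w ·s k) a                    ≡⟨ wa≡wb ⟩
    lookup (w ·s k) b                    ≡⟨ lookup-·s w k b ⟩
    lookup w (swapAdjacent k b)          ∎)) ⟩
  swapAdjacent k (swapAdjacent k b)    ≡⟨ swapAdjacent-involutive k b ⟩
  b                                    ∎

inject₁≢suc : ∀ {n} (k : Fin n) → inject₁ k ≢ suc k
inject₁≢suc zero    ()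
inject₁≢suc (suc k) e = inject₁≢suc k (Fin.suc-injective e)

ascent-or-descent : ∀ {n} (w : Word (suc n)) → IsPerm w → ∀ k → Ascent (lookup w) k ⊎ Descent (lookup w) k
ascent-or-descent w perm k with Fin.<-cmp (lookup w (inject₁ k)) (lookup w (suc k))
... | tri< w↑ _ _ = inj₁ w↑
... | tri≈ _ e _  = ⊥-elim (inject₁≢suc k (perm _ _ e))
... | tri> _ _ w↓ = inj₂ w↓

·s-descent⇒ascent : ∀ {n} (w : Word (suc n)) (k : Fin n) → Descent (lookup w) k → Ascent (lookup (w ·s k)) k
·s-descent⇒ascent w k =
  subst₂ _<_ (sym (trans (lookup-·s w k (inject₁ k)) (cong (lookup w) (swapAdjacent-inject₁ k))))
             (sym (trans (lookup-·s w k (suc k)) (cong (lookup w) (swapAdjacent-suc k))))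

word-ext : ∀ {n} {u v : Word n} → (∀ m → lookup u m ≡ lookup v m) → u ≡ v
word-ext {u = u} {v} u≗v = trans (sym (tabulate∘lookup u)) (trans (tabulate-cong u≗v) (tabulate∘lookup v))

inversion : ∀ {n} → Word n → Fin n → Fin n → ℕ
inversion w a b = 𝟙 ((toℕ a <ᵇ toℕ b) ∧ (toℕ (lookup w b) <ᵇ toℕ (lookup w a)))

len≡∑∑inversion : ∀ {n} (w : Word n) → len w ≡ ∑[ a < n ] ∑[ b < n ] inversion w a b
len≡∑∑inversion w =
  trans (sum-tabulate (λ a → Vec.sum (tabulate (inversion w a)))) (sum-cong-≗ (λ a → sum-tabulate (inversion w a)))

len-idW : ∀ n → len (idW n) ≡ 0
len-idW n = begin
  len (idW n)                                    ≡⟨ len≡∑∑inversion (idW n) ⟩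
  ∑[ a < n ] ∑[ b < n ] inversion (idW n) a b    ≡⟨ sum-cong-≗ (λ a → sum-cong-≗ (λ b → no-inversion a b)) ⟩
  ∑[ a < n ] ∑[ b < n ] 0                        ≡⟨ sum-cong-≗ {n} (λ _ → sum-zeros n) ⟩
  ∑[ a < n ] 0                                   ≡⟨ sum-zeros n ⟩
  0                                              ∎
  where
  no-inversion : ∀ a b → inversion (idW n) a b ≡ 0
  no-inversion a b rewrite lookup-allFin a | lookup-allFin b = cong 𝟙 (<ᵇ-asym (toℕ a) (toℕ b))

len-w0 : ∀ n → len (w0 n) ≡ n C 2
len-w0 n = begin
  len (w0 n)                                     ≡⟨ len≡∑∑inversion (w0 n) ⟩
  ∑[ a < n ] ∑[ b < n ] inversion (w0 n) a b     ≡⟨ sum-cong-≗ (λ a → sum-cong-≗ (λ b → inversion-w0 a b)) ⟩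
  ∑[ a < n ] ∑[ b < n ] 𝟙 (toℕ a <ᵇ toℕ b)       ≡⟨ ordered-pairs-count n ⟩
  n C 2                                          ∎
  where
  inversion-w0 : ∀ a b → inversion (w0 n) a b ≡ 𝟙 (toℕ a <ᵇ toℕ b)
  inversion-w0 a b rewrite lookup∘tabulate opposite a | lookup∘tabulate opposite b | opposite-<ᵇ a b =
    cong 𝟙 (∧-idem (toℕ a <ᵇ toℕ b))

-- Reindexing both summation variables by s_k leaves every summand of l(w) unchanged except
-- the one at (k+1, k), which becomes an inversion; (k, k+1) is an inversion in neither sum
-- because k is an ascent of w.
len-·s-ascent : ∀ {n} (w : Word (suc n)) (k : Fin n) → Ascent (lookup w) k → len (w ·s k) ≡ suc (len w)
len-·s-ascent {n} w k w↑ = begin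
  len (w ·s k)                                                  ≡⟨ len≡∑∑inversion (w ·s k) ⟩
  ∑[ a < suc n ] ∑[ b < suc n ] inversion (w ·s k) a b          ≡⟨ sum-swapAdjacent k (λ a → ∑[ b < suc n ] inversion (w ·s k) a b) ⟩
  ∑[ a < suc n ] ∑[ b < suc n ] inversion (w ·s k) (τ a) b      ≡⟨ sum-cong-≗ (λ a → sum-swapAdjacent k (inversion (w ·s k) (τ a))) ⟩
  ∑[ a < suc n ] ∑[ b < suc n ] inversion (w ·s k) (τ a) (τ b)  ≡⟨ sum-cong-≗ (λ a → sum-cong-≗ (λ b → unswap a b)) ⟩
  ∑[ a < suc n ] ∑[ b < suc n ] reindexed a b                   ≡⟨ one-new-inversion ⟩
  suc (∑[ a < suc n ] ∑[ b < suc n ] inversion w a b)           ≡⟨ cong suc (len≡∑∑inversion w) ⟨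
  suc (len w)                                                   ∎
  where
  τ : Fin (suc n) → Fin (suc n)
  τ = swapAdjacent k

  inverted : Fin (suc n) → Fin (suc n) → Bool
  inverted a b = toℕ (lookup w b) <ᵇ toℕ (lookup w a)

  reindexed : Fin (suc n) → Fin (suc n) → ℕ
  reindexed a b = 𝟙 ((toℕ (τ a) <ᵇ toℕ (τ b)) ∧ inverted a b)

  unswap : ∀ a b → inversion (w ·s k) (τ a) (τ b) ≡ reindexed a b
  unswap a b = cong₂ (λ x y → 𝟙 ((toℕ (τ a) <ᵇ toℕ (τ b)) ∧ (toℕ x <ᵇ toℕ y)))
    (lookup-·s-swapAdjacent w k b) (lookup-·s-swapAdjacent w k a)

  unchanged : ∀ a b → (a ≡ suc k → b ≢ inject₁ k) → reindexed a b ≡ inversion w a b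
  unchanged a b not-new with a Fin.≟ inject₁ k | b Fin.≟ suc k
  ... | yes refl | yes refl = cong 𝟙 (trans (ascent-not-inverted _) (sym (ascent-not-inverted _)))
    where
    ascent-not-inverted : ∀ x → (x ∧ inverted (inject₁ k) (suc k)) ≡ false
    ascent-not-inverted x = trans (cong (x ∧_) (≤⇒>ᵇ≡false (ℕ.<⇒≤ w↑))) (∧-zeroʳ x)
  ... | no a≢ | _     = cong (λ x → 𝟙 (x ∧ inverted a b)) (swapAdjacent-<ᵇ k a b (λ a≡ → ⊥-elim (a≢ a≡)) not-new)
  ... | _     | no b≢ = cong (λ x → 𝟙 (x ∧ inverted a b)) (swapAdjacent-<ᵇ k a b (λ _ → b≢) not-new)

  new-inversion : reindexed (suc k) (inject₁ k) ≡ suc (inversion w (suc k) (inject₁ k))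
  new-inversion rewrite swapAdjacent-suc k | swapAdjacent-inject₁ k | inject₁<ᵇsuc k | suc<ᵇinject₁ k
                      | <⇒<ᵇ≡true w↑ = refl

  one-new-inversion : ∑[ a < suc n ] ∑[ b < suc n ] reindexed a b ≡ suc (∑[ a < suc n ] ∑[ b < suc n ] inversion w a b)
  one-new-inversion =
    sum-suc-at (suc k) (λ a a≢ → sum-cong-≗ (λ b → unchanged a b (λ a≡ _ → a≢ a≡)))
      (sum-suc-at (inject₁ k) (λ b b≢ → unchanged (suc k) b (λ _ → b≢)) new-inversion)

len-·s-descent : ∀ {n} (w : Word (suc n)) (k : Fin n) → Descent (lookup w) k → len w ≡ suc (len (w ·s k))
len-·s-descent w k w↓ = trans (cong len (sym (·s-involutive w k))) (len-·s-ascent (w ·s k) k (·s-descent⇒ascent w k w↓))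

idW-IsPerm : ∀ n → IsPerm (idW n)
idW-IsPerm n a b e = trans (sym (lookup-allFin a)) (trans e (lookup-allFin b))

idW-ascent : ∀ {n} (k : Fin n) → Ascent (lookup (idW (suc n))) k
idW-ascent k = subst₂ _<_ (sym (lookup-allFin (inject₁ k))) (sym (lookup-allFin (suc k)))
  (s≤s (ℕ.≤-reflexive (toℕ-inject₁ k)))

adjacent : ∀ {n} (k : Fin n) → toℕ (suc k) ≡ suc (toℕ (inject₁ k))
adjacent k = cong suc (sym (toℕ-inject₁ k))

Complementary : ∀ {n} → Word n → Word n → Set
Complementary π σ = ∀ m → lookup π m ≡ opposite (lookup σ m)

complementary-·s : ∀ {n} (π σ : Word (suc n)) (k : Fin n) → Complementary π σ → Complementary (π ·s k) (σ ·s k)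
complementary-·s π σ k π≡w0σ m = begin
  lookup (π ·s k) m                          ≡⟨ lookup-·s π k m ⟩
  lookup π (swapAdjacent k m)                ≡⟨ π≡w0σ (swapAdjacent k m) ⟩
  opposite (lookup σ (swapAdjacent k m))     ≡⟨ cong opposite (lookup-·s σ k m) ⟨
  opposite (lookup (σ ·s k) m)               ∎

SwapTransfer : ∀ {n} → (Word n → Word n → Word n → ℤ) → Set
SwapTransfer {n} f = ∀ (u v w : Word n) → IsPerm u → IsPerm v → IsPerm w →
  suc (len u + len v + len w) ≡ n C 2 →
  ∀ (i j : Fin n) → toℕ j ≡ suc (toℕ i) →
  lookup u i < lookup u j → lookup v i < lookup v j → lookup w i < lookup w j →
  (f (swapAt u i j) v w ≡ f u (swapAt v i j) w) × (f u (swapAt v i j) w ≡ f u v (swapAt w i j))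

VanishesAtCommonAscent : ∀ {n} → (Word n → Word n → Word n → ℤ) → Set
VanishesAtCommonAscent {n} f = ∀ (u v w : Word n) → IsPerm u → IsPerm v → IsPerm w →
  len u + len v + len w ≡ n C 2 →
  ∀ (i j : Fin n) → toℕ j ≡ suc (toℕ i) →
  lookup u i < lookup u j → lookup v i < lookup v j → lookup w i < lookup w j →
  f u v w ≡ + 0

module _ {n} (f : Word (suc n) → Word (suc n) → Word (suc n) → ℤ)
  (transfer : SwapTransfer f) (vanish : VanishesAtCommonAscent f)
  (normalised : f (idW (suc n)) (idW (suc n)) (w0 (suc n)) ≡ + 1) where

  private
    N : ℕ
    N = suc n

    id : Word N
    id = idW N

  PredictedValue : Word N → Word N → Set
  PredictedValue π σ = (Complementary π σ → f π id σ ≡ + 1) × (¬ Complementary π σ → f π id σ ≡ + 0)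

  len-with-id : ∀ (u w : Word N) → len u + len id + len w ≡ len u + len w
  len-with-id u w = cong (_+ len w) (trans (cong (λ x → len u + x) (len-idW N)) (ℕ.+-identityʳ (len u)))

  common-ascent : ∀ π σ (k : Fin n) → IsPerm π → IsPerm σ → len π + len σ ≡ N C 2 →
    Ascent (lookup π) k → Ascent (lookup σ) k → PredictedValue π σ
  common-ascent π σ k pπ pσ total π↑ σ↑ = (λ c → ⊥-elim (not-complementary c)) , λ _ → vanishes
    where
    vanishes : f π id σ ≡ + 0
    vanishes = vanish π id σ pπ (idW-IsPerm N) pσ (trans (len-with-id π σ) total)
      (inject₁ k) (suc k) (adjacent k) π↑ (idW-ascent k) σ↑

    not-complementary : ¬ Complementary π σ
    not-complementary c =
      Fin.<-asym π↑ (subst₂ _<_ (sym (c (suc k))) (sym (c (inject₁ k))) (opposite-reverses-< σ↑))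

  descent-ascent : ∀ π σ (k : Fin n) → IsPerm π → IsPerm σ → len π + len σ ≡ N C 2 →
    Descent (lookup π) k → Ascent (lookup σ) k →
    (len (π ·s k) + len (σ ·s k) ≡ N C 2 → PredictedValue (π ·s k) (σ ·s k)) → PredictedValue π σ
  descent-ascent π σ k pπ pσ total π↓ σ↑ rec =
    (λ c → trans moved (proj₁ predicted (complementary-·s π σ k c))) ,
    (λ ¬c → trans moved (proj₂ predicted (¬c ∘ unswap)))
    where
    u : Word N
    u = π ·s k

    len-π : len π ≡ suc (len u)
    len-π = len-·s-descent π k π↓

    predicted : PredictedValue u (σ ·s k)
    predicted = rec (begin
      len u + len (σ ·s k)    ≡⟨ cong (λ x → len u + x) (len-·s-ascent σ k σ↑) ⟩
      len u + suc (len σ)     ≡⟨ ℕ.+-suc (len u) (len σ) ⟩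
      suc (len u) + len σ     ≡⟨ cong (_+ len σ) len-π ⟨
      len π + len σ           ≡⟨ total ⟩
      N C 2                   ∎)

    transferred : (f (u ·s k) id σ ≡ f u (id ·s k) σ) × (f u (id ·s k) σ ≡ f u id (σ ·s k))
    transferred = transfer u id σ (·s-preserves-IsPerm π k pπ) (idW-IsPerm N) pσ
      (trans (cong suc (len-with-id u σ)) (trans (cong (_+ len σ) (sym len-π)) total))
      (inject₁ k) (suc k) (adjacent k) (·s-descent⇒ascent π k π↓) (idW-ascent k) σ↑

    moved : f π id σ ≡ f u id (σ ·s k)
    moved = begin
      f π id σ          ≡⟨ cong (λ x → f x id σ) (·s-involutive π k) ⟨
      f (u ·s k) id σ   ≡⟨ trans (proj₁ transferred) (proj₂ transferred) ⟩
      f u id (σ ·s k)   ∎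

    unswap : Complementary u (σ ·s k) → Complementary π σ
    unswap c = subst₂ Complementary (·s-involutive π k) (·s-involutive σ k) (complementary-·s u (σ ·s k) k c)

  no-ascent : ∀ π σ → IsPerm π → len π + len σ ≡ N C 2 →
    (∀ k → Descent (lookup σ) k) → PredictedValue π σ
  no-ascent π σ pπ total σ↓ = (λ _ → value) , (λ ¬c → ⊥-elim (¬c complementary))
    where
    σ-opposite : ∀ m → lookup σ m ≡ opposite m
    σ-opposite = descending⇒≡opposite (lookup σ) σ↓

    σ≡w0 : σ ≡ w0 N
    σ≡w0 = word-ext (λ m → trans (σ-opposite m) (sym (lookup∘tabulate opposite m)))

    len-π : len π ≡ 0
    len-π = ℕ.+-cancelʳ-≡ (N C 2) (len π) 0
      (trans (cong (λ x → len π + x) (sym (trans (cong len σ≡w0) (len-w0 N)))) total)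

    π-id : ∀ m → lookup π m ≡ m
    π-id = ascending⇒≡id (lookup π) π↑
      where
      π↑ : ∀ k → Ascent (lookup π) k
      π↑ k with ascent-or-descent π pπ k
      ... | inj₁ π↑k = π↑k
      ... | inj₂ π↓k with () ← trans (sym len-π) (len-·s-descent π k π↓k)

    π≡id : π ≡ id
    π≡id = word-ext (λ m → trans (π-id m) (sym (lookup-allFin m)))

    value : f π id σ ≡ + 1
    value = subst₂ (λ x y → f x id y ≡ + 1) (sym π≡id) (sym σ≡w0) normalised

    complementary : Complementary π σ
    complementary m = begin
      lookup π m              ≡⟨ π-id m ⟩
      m                       ≡⟨ opposite-involutive m ⟨
      opposite (opposite m)   ≡⟨ cong opposite (σ-opposite m) ⟨
      opposite (lookup σ m)   ∎

  predicted-value : ∀ π σ → IsPerm π → IsPerm σ → len π + len σ ≡ N C 2 → PredictedValue π σ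
  predicted-value π σ = <-rec Goal step (len π) π σ refl
    where
    Goal : ℕ → Set
    Goal l = ∀ π σ → len π ≡ l → IsPerm π → IsPerm σ → len π + len σ ≡ N C 2 → PredictedValue π σ

    step : ∀ l → (∀ {l′} → l′ ℕ.< l → Goal l′) → Goal l
    step _ shorter π σ refl pπ pσ total with Fin.any? (λ k → lookup σ (inject₁ k) Fin.<? lookup σ (suc k))
    ... | no no-σ↑ = no-ascent π σ pπ total σ↓
      where
      σ↓ : ∀ k → Descent (lookup σ) k
      σ↓ k with ascent-or-descent σ pσ k
      ... | inj₁ σ↑ = ⊥-elim (no-σ↑ (k , σ↑))
      ... | inj₂ σ↓k = σ↓k
    ... | yes (k , σ↑) with ascent-or-descent π pπ k
    ...   | inj₁ π↑ = common-ascent π σ k pπ pσ total π↑ σ↑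
    ...   | inj₂ π↓ = descent-ascent π σ k pπ pσ total π↓ σ↑
      (shorter (ℕ.≤-reflexive (sym (len-·s-descent π k π↓))) (π ·s k) (σ ·s k) refl
        (·s-preserves-IsPerm π k pπ) (·s-preserves-IsPerm σ k pσ))

lemma4 : (n : ℕ) → 2 ≤ n → (f : Word n → Word n → Word n → ℤ) →
    (∀ (u v w : Word n) → IsPerm u → IsPerm v → IsPerm w →
      suc (len u + len v + len w) ≡ n C 2 →
      ∀ (i j : Fin n) → toℕ j ≡ suc (toℕ i) →
      lookup u i < lookup u j → lookup v i < lookup v j → lookup w i < lookup w j →
      (f (swapAt u i j) v w ≡ f u (swapAt v i j) w) × (f u (swapAt v i j) w ≡ f u v (swapAt w i j))) →
    (∀ (u v w : Word n) → IsPerm u → IsPerm v → IsPerm w →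
      len u + len v + len w ≡ n C 2 →
      ∀ (i j : Fin n) → toℕ j ≡ suc (toℕ i) →
      lookup u i < lookup u j → lookup v i < lookup v j → lookup w i < lookup w j →
      f u v w ≡ + 0) →
    f (idW n) (idW n) (w0 n) ≡ + 1 →
    ∀ (π σ : Word n) → IsPerm π → IsPerm σ → len π + len σ ≡ n C 2 →
      ((∀ (m : Fin n) → lookup π m ≡ opposite (lookup σ m)) → f π (idW n) σ ≡ + 1) ×
      (¬ (∀ (m : Fin n) → lookup π m ≡ opposite (lookup σ m)) → f π (idW n) σ ≡ + 0)
lemma4 zero ()
lemma4 (suc n) _ f transfer vanish normalised = predicted-value f transfer vanish normalised
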